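{- Let $A=(B,C^s,C^t,\mathcal{B})$ be a dynamic contact algebra. On the set $Ult(A)$ of ultrafilters of $B$ define $UR^tV$ iff $\forall a\in U,b\in V\,(aC^tb)$, and $U\prec V$ iff $\forall a\in U,b\in V\,(a\mathcal{B}b)$; on the set $Clusters(A)$ define $\Gamma\prec\Delta$ iff $\forall a\in\Gamma,b\in\Delta\,(a\mathcal{B}b)$. Then for each of the following rows, the three conditions (i) the ultrafilter condition holds in $(Ult(A),\prec,R^t)$; (ii) the cluster condition (obtained from the ultrafilter condition by letting the variables range over $Clusters(A)$ and replacing $R^t$ by equality) holds in $(Clusters(A),\prec)$; (iii) the axiom holds in $A$ (variables universally quantified over $B$) are equivalent: $\forall U\exists V\,U\prec V$ / (rs) $a\neq0\Rightarrow a\mathcal{B}1$; $\forall U\exists V\,V\prec U$ / (ls) $a\neq0\Rightarrow 1\mathcal{B}a$; $\forall U,V\exists W\,(U\prec W$ and $V\prec W)$ / (up dir) $a\neq0,b\neq0\Rightarrow a\mathcal{B}p$ or $b\mathcal{B}p^*$; $\forall U,V\exists W\,(W\prec U$ and $W\prec V)$ / (down dir) $a\neq0,b\neq0\Rightarrow p\mathcal{B}a$ or $p^*\mathcal{B}b$; $U\prec V\Rightarrow\exists W\,(W\prec U$ and $V\prec W)$ / (circ) $a\mathcal{B}b\Rightarrow b\mathcal{B}p$ or $p^*\mathcal{B}a$; $U\prec V\Rightarrow\exists W\,(U\prec W$ and $W\prec V)$ / (dens) $a\mathcal{B}b\Rightarrow a\mathcal{B}p$ or $p^*\mathcal{B}b$;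 $\forall U\,U\prec U$ / (ref) $aC^tb\Rightarrow a\mathcal{B}b$; $\forall U,V\,(U\prec V$ or $V\prec U)$ / (lin) $a\neq0,b\neq0\Rightarrow a\mathcal{B}b$ or $b\mathcal{B}a$; $\forall U,V\,(UR^tV$ or $U\prec V$ or $V\prec U)$ / (tri) $a\neq0,b\neq0\Rightarrow aC^tb$ or $a\mathcal{B}b$ or $b\mathcal{B}a$; $U\prec V$ and $V\prec W\Rightarrow U\prec W$ / (tr) $a\overline{\mathcal{B}}b\Rightarrow\exists c\,(a\overline{\mathcal{B}}c$ and $c^*\overline{\mathcal{B}}b)$.
   Context: A precontact relation on a Boolean algebra $(B,0,1,\le,+,\cdot,{}^*)$ is a binary relation $C$ with: $aCb\Rightarrow a\neq0,b\neq0$; $aCb$, $a\le a'$, $b\le b'\Rightarrow a'Cb'$; $aC(b+c)\Rightarrow aCb$ or $aCc$; $(a+b)Cc\Rightarrow aCc$ or $bCc$. A contact relation is a symmetric precontact relation with $a\cdot b\neq0\Rightarrow aCb$. $\overline{C}$ is the complement of $C$. A dynamic contact algebra (DCA) is $A=(B,C^s,C^t,\mathcal{B})$ with $B$ a Boolean algebra with $0\neq1$, $C^s,C^t$ contact relations, $\mathcal{B}$ a precontact relation, such that for all $a,b$: $aC^sb\Rightarrow aC^tb$; $a\overline{C^t}b\Rightarrow\exists c\,(a\overline{C^t}c$ and $c^*\overline{C^t}b)$; $a\overline{\mathcal{B}}b\Rightarrow\exists c\,(a\overline{C^t}c$ and $c^*\overline{\mathcal{B}}b)$; $a\overline{\mathcal{B}}b\Rightarrow\exists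 c\,(a\overline{\mathcal{B}}c$ and $c^*\overline{C^t}b)$. A t-clan of $A$ is a set $\Gamma\subseteq B$ with $1\in\Gamma$, $0\notin\Gamma$, upward closed, $a+b\in\Gamma\Rightarrow a\in\Gamma$ or $b\in\Gamma$, and $a,b\in\Gamma\Rightarrow aC^tb$. A cluster is a t-clan $\Gamma$ such that for every $a\notin\Gamma$ there is $b\in\Gamma$ with $a\overline{C^t}b$; $Clusters(A)$ is the set of clusters. -}

module Defs where

open import Level using (Level; suc; _⊔_; Lift)
open import Algebra.Lattice.Bundles using (BooleanAlgebra)
open import Data.Product using (Σ; ∃; _×_; _,_)
open import Data.Sum using (_⊎_)
open import Relation.Nullary using (¬_)
open import Relation.Unary using (Pred; _⊆_)
open import Function.Bundles using (_⇔_)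

-- Notions relative to a Boolean algebra B (carrier and relations at level ℓ).
-- Paper notation:  0 = ⊥,  1 = ⊤,  a + b = a ∨ b,  a · b = a ∧ b,  a* = ¬ a,
-- a ≤ b  iff  a ∧ b ≈ a.

module BA {ℓ : Level} (B : BooleanAlgebra ℓ ℓ) where
  open BooleanAlgebra B hiding (¬_)

  -- complement a* (the algebra's ¬_, renamed to avoid a clash with negation)
  infix 9 _*
  _* : Carrier → Carrier
  a * = BooleanAlgebra.¬_ B a

  _≤_ : Carrier → Carrier → Set ℓ
  a ≤ b = (a ∧ b) ≈ a

  BRel : Set (suc ℓ)
  BRel = Carrier → Carrier → Set ℓ

  record IsPrecontact (C : BRel) : Set ℓ where
    field
      nonzeroˡ : ∀ {a b} → C a b → ¬ (a ≈ ⊥)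
      nonzeroʳ : ∀ {a b} → C a b → ¬ (b ≈ ⊥)
      mono     : ∀ {a b a' b'} → C a b → a ≤ a' → b ≤ b' → C a' b'
      splitʳ   : ∀ {a b c} → C a (b ∨ c) → C a b ⊎ C a c
      splitˡ   : ∀ {a b c} → C (a ∨ b) c → C a c ⊎ C b c

  record IsContact (C : BRel) : Set ℓ where
    field
      isPrecontact : IsPrecontact C
      sym          : ∀ {a b} → C a b → C b a
      meet-contact : ∀ {a b} → ¬ ((a ∧ b) ≈ ⊥) → C a b

  record IsFilter (F : Pred Carrier ℓ) : Set ℓ where
    field
      top    : F ⊤
      upward : ∀ {a b} → F a → a ≤ b → F b
      meet   : ∀ {a b} → F a → F b → F (a ∧ b)

  record IsUltrafilter (U : Pred Carrier ℓ) : Set ℓ where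
    field
      isFilter : IsFilter U
      proper   : ¬ U ⊥
      ultra    : ∀ a → U a ⊎ U (a *)

  UltrafilterLemma : Set (suc ℓ)
  UltrafilterLemma =
    (F : Pred Carrier ℓ) → IsFilter F → ¬ F ⊥ →
    Σ (Pred Carrier ℓ) λ U → IsUltrafilter U × (F ⊆ U)

record DCA (ℓ : Level) : Set (suc ℓ) where
  field
    B : BooleanAlgebra ℓ ℓ
  open BooleanAlgebra B hiding (¬_)
  open BA B
  field
    Cs Ct 𝓑     : BRel
    nontrivial  : ¬ (⊥ ≈ ⊤)
    Cs-contact  : IsContact Cs
    Ct-contact  : IsContact Ct
    𝓑-precontact : IsPrecontact 𝓑
    Cs⇒Ct       : ∀ {a b} → Cs a b → Ct a b
    Ct-interp   : ∀ {a b} → ¬ Ct a b → ∃ λ c → ¬ Ct a c × ¬ Ct (c *) b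
    𝓑-interpˡ   : ∀ {a b} → ¬ 𝓑 a b → ∃ λ c → ¬ Ct a c × ¬ 𝓑 (c *) b
    𝓑-interpʳ   : ∀ {a b} → ¬ 𝓑 a b → ∃ λ c → ¬ 𝓑 a c × ¬ Ct (c *) b

module OnDCA {ℓ : Level} (A : DCA ℓ) where
  open DCA A
  open BooleanAlgebra B hiding (¬_)
  open BA B

  Subset : Set (suc ℓ)
  Subset = Pred Carrier ℓ

  Ult : Subset → Set ℓ
  Ult = IsUltrafilter

  record IsTClan (Γ : Subset) : Set ℓ where
    field
      top     : Γ ⊤
      bot     : ¬ Γ ⊥
      upward  : ∀ {a b} → Γ a → a ≤ b → Γ b
      prime   : ∀ {a b} → Γ (a ∨ b) → Γ a ⊎ Γ b
      contact : ∀ {a b} → Γ a → Γ b → Ct a b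

  record IsCluster (Γ : Subset) : Set ℓ where
    field
      isTClan : IsTClan Γ
      maximal : ∀ a → ¬ Γ a → ∃ λ b → Γ b × ¬ Ct a b

  Rt : Subset → Subset → Set ℓ
  Rt U V = ∀ a b → U a → V b → Ct a b

  _≺_ : Subset → Subset → Set ℓ
  U ≺ V = ∀ a b → U a → V b → 𝓑 a b

  _≐_ : Subset → Subset → Set ℓ
  Γ ≐ Δ = (Γ ⊆ Δ) × (Δ ⊆ Γ)

  All : (Subset → Set ℓ) → (Subset → Set (suc ℓ)) → Set (suc ℓ)
  All K P = ∀ U → K U → P U

  Ex : (Subset → Set ℓ) → (Subset → Set ℓ) → Set (suc ℓ)
  Ex K P = Σ Subset λ U → K U × P U

  -- ultrafilter / cluster conditions, parametrised by the class K of
  -- points and the relation R (R^t for ultrafilters, ≐ for clusters)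

  SerialR : (Subset → Set ℓ) → Set (suc ℓ)
  SerialR K = All K λ U → Ex K λ V → U ≺ V

  SerialL : (Subset → Set ℓ) → Set (suc ℓ)
  SerialL K = All K λ U → Ex K λ V → V ≺ U

  UpDir : (Subset → Set ℓ) → Set (suc ℓ)
  UpDir K = All K λ U → All K λ V → Ex K λ W → U ≺ W × V ≺ W

  DownDir : (Subset → Set ℓ) → Set (suc ℓ)
  DownDir K = All K λ U → All K λ V → Ex K λ W → W ≺ U × W ≺ V

  Circ : (Subset → Set ℓ) → Set (suc ℓ)
  Circ K = All K λ U → All K λ V → U ≺ V → Ex K λ W → W ≺ U × V ≺ W

  Dens : (Subset → Set ℓ) → Set (suc ℓ)
  Dens K = All K λ U → All K λ V → U ≺ V → Ex K λ W → U ≺ W × W ≺ V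

  Refl : (Subset → Set ℓ) → Set (suc ℓ)
  Refl K = All K λ U → Lift (suc ℓ) (U ≺ U)

  Lin : (Subset → Set ℓ) → Set (suc ℓ)
  Lin K = All K λ U → All K λ V → Lift (suc ℓ) (U ≺ V ⊎ V ≺ U)

  Tri : (Subset → Set ℓ) → (Subset → Subset → Set ℓ) → Set (suc ℓ)
  Tri K R = All K λ U → All K λ V →
            Lift (suc ℓ) (R U V ⊎ U ≺ V ⊎ V ≺ U)

  Trans : (Subset → Set ℓ) → Set (suc ℓ)
  Trans K = All K λ U → All K λ V → All K λ W →
            Lift (suc ℓ) (U ≺ V → V ≺ W → U ≺ W)

  rs : Set ℓ
  rs = ∀ a → ¬ (a ≈ ⊥) → 𝓑 a ⊤

  ls : Set ℓ
  ls = ∀ a → ¬ (a ≈ ⊥) → 𝓑 ⊤ a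

  up-dir : Set ℓ
  up-dir = ∀ a b p → ¬ (a ≈ ⊥) → ¬ (b ≈ ⊥) → 𝓑 a p ⊎ 𝓑 b (p *)

  down-dir : Set ℓ
  down-dir = ∀ a b p → ¬ (a ≈ ⊥) → ¬ (b ≈ ⊥) → 𝓑 p a ⊎ 𝓑 (p *) b

  circ : Set ℓ
  circ = ∀ a b p → 𝓑 a b → 𝓑 b p ⊎ 𝓑 (p *) a

  dens : Set ℓ
  dens = ∀ a b p → 𝓑 a b → 𝓑 a p ⊎ 𝓑 (p *) b

  ref : Set ℓ
  ref = ∀ a b → Ct a b → 𝓑 a b

  lin : Set ℓ
  lin = ∀ a b → ¬ (a ≈ ⊥) → ¬ (b ≈ ⊥) → 𝓑 a b ⊎ 𝓑 b a

  tri : Set ℓ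
  tri = ∀ a b → ¬ (a ≈ ⊥) → ¬ (b ≈ ⊥) → Ct a b ⊎ 𝓑 a b ⊎ 𝓑 b a

  tr : Set ℓ
  tr = ∀ a b → ¬ 𝓑 a b → ∃ λ c → ¬ 𝓑 a c × ¬ 𝓑 (c *) b

  Row : Set (suc ℓ) → Set (suc ℓ) → Set ℓ → Set (suc ℓ)
  Row U C Ax = (U ⇔ Lift (suc ℓ) Ax) × (C ⇔ Lift (suc ℓ) Ax)

  AllRows : Set (suc ℓ)
  AllRows =
      Row (SerialR Ult) (SerialR IsCluster) rs
    × Row (SerialL Ult) (SerialL IsCluster) ls
    × Row (UpDir Ult)   (UpDir IsCluster)   up-dir
    × Row (DownDir Ult) (DownDir IsCluster) down-dir
    × Row (Circ Ult)    (Circ IsCluster)    circ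
    × Row (Dens Ult)    (Dens IsCluster)    dens
    × Row (Refl Ult)    (Refl IsCluster)    ref
    × Row (Lin Ult)     (Lin IsCluster)     lin
    × Row (Tri Ult Rt)  (Tri IsCluster _≐_) tri
    × Row (Trans Ult)   (Trans IsCluster)   tr

-- Every cluster Γ equals clusterOf U = {a | a Ct b for all b ∈ U} for any ultrafilter U ⊆ Γ, and
-- U ↦ clusterOf U preserves ≺ (the interpolation axioms for 𝓑 push a failure of 𝓑 between the
-- clusters down to the ultrafilters) and turns R^t into equality. As this correspondence is total in
-- both directions, every first-order condition built from ≺ transfers between ultrafilters and clusters.
-- Each ultrafilter condition is matched with its axiom by constructing the required ultrafilters
-- through filter-ideal separation: for a precontact relation R and a filter F, the elements b with
-- ¬ R a b for some a ∈ F form an ideal, and an ultrafilter avoiding that ideal is R-related to all of F.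

module Submission where

open import Level using (Level; suc; Lift; lift; lower)
open import Algebra.Lattice.Bundles using (BooleanAlgebra)
open import Axiom.ExcludedMiddle using (ExcludedMiddle)
open import Axiom.DoubleNegationElimination using (DoubleNegationElimination; em⇒dne)
open import Data.Empty using (⊥-elim)
open import Data.Product using (∃; ∃₂; _×_; _,_; proj₁)
open import Data.Product.Function.NonDependent.Propositional using (_×-⇔_)
open import Data.Sum using (_⊎_; inj₁; inj₂; [_,_])
import Data.Sum as Sum
open import Data.Sum.Function.Propositional using (_⊎-⇔_)
open import Function using (flip)
open import Function.Bundles using (_⇔_; mk⇔; Equivalence)
open import Function.Construct.Composition using (_⇔-∘_)
open import Function.Construct.Symmetry using (⇔-sym)
open import Function.Related.TypeIsomorphisms using (→-cong-⇔)
open import Relation.Nullary using (¬_)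
open import Relation.Nullary.Decidable using (map′)
open import Relation.Unary using (Pred; _⊆_; ∁)
open import Relation.Unary.Properties using (≐-sym; ≐-trans)
open import Defs

lower-excludedMiddle : ∀ {ℓ} → ExcludedMiddle (suc ℓ) → ExcludedMiddle ℓ
lower-excludedMiddle em = map′ lower lift em

Lift-cong : ∀ {a b ℓ} {P : Set a} {Q : Set b} → P ⇔ Q → Lift ℓ P ⇔ Lift ℓ Q
Lift-cong P⇔Q = mk⇔ (λ (lift p) → lift (Equivalence.to P⇔Q p))
                    (λ (lift q) → lift (Equivalence.from P⇔Q q))

module BooleanOrder {ℓ : Level} (B : BooleanAlgebra ℓ ℓ) where
  open BooleanAlgebra B hiding (¬_)
  open BA B
  open import Algebra.Lattice.Properties.BooleanAlgebra B
    using (∧-identityʳ; ∧-zeroˡ; ∧-zeroʳ; ∨-identityʳ; ¬-involutive; deMorgan₂; ¬⊤≈⊥)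
  open import Algebra.Lattice.Properties.Lattice lattice using (∨-∧-isOrderTheoreticLattice)
  import Relation.Binary.Lattice.Structures as Order
  open import Relation.Binary.Reasoning.Setoid setoid

  -- The library's lattice order is  x ≈ x ∧ y,  the symmetric form of  BA._≤_.
  private module L = Order.IsLattice ∨-∧-isOrderTheoreticLattice

  ≤-refl : ∀ {x} → x ≤ x
  ≤-refl = sym L.refl

  ≈⇒≤ : ∀ {x y} → x ≈ y → x ≤ y
  ≈⇒≤ x≈y = sym (L.reflexive x≈y)

  ≤-trans : ∀ {x y z} → x ≤ y → y ≤ z → x ≤ z
  ≤-trans x≤y y≤z = sym (L.trans (sym x≤y) (sym y≤z))

  x∧y≤x : ∀ {x y} → (x ∧ y) ≤ x
  x∧y≤x = sym (L.x∧y≤x _ _)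

  x∧y≤y : ∀ {x y} → (x ∧ y) ≤ y
  x∧y≤y = sym (L.x∧y≤y _ _)

  ∧-greatest : ∀ {x y z} → z ≤ x → z ≤ y → z ≤ (x ∧ y)
  ∧-greatest z≤x z≤y = sym (L.∧-greatest (sym z≤x) (sym z≤y))

  x≤x∨y : ∀ {x y} → x ≤ (x ∨ y)
  x≤x∨y = sym (L.x≤x∨y _ _)

  y≤x∨y : ∀ {x y} → y ≤ (x ∨ y)
  y≤x∨y = sym (L.y≤x∨y _ _)

  ∨-least : ∀ {x y z} → x ≤ z → y ≤ z → (x ∨ y) ≤ z
  ∨-least x≤z y≤z = sym (L.∨-least (sym x≤z) (sym y≤z))

  ∧-monotonic : ∀ {x y x′ y′} → x ≤ x′ → y ≤ y′ → (x ∧ y) ≤ (x′ ∧ y′)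
  ∧-monotonic x≤x′ y≤y′ = ∧-greatest (≤-trans x∧y≤x x≤x′) (≤-trans x∧y≤y y≤y′)

  ∨-monotonic : ∀ {x y x′ y′} → x ≤ x′ → y ≤ y′ → (x ∨ y) ≤ (x′ ∨ y′)
  ∨-monotonic x≤x′ y≤y′ = ∨-least (≤-trans x≤x′ x≤x∨y) (≤-trans y≤y′ y≤x∨y)

  ⊥≤x : ∀ {x} → ⊥ ≤ x
  ⊥≤x = ∧-zeroˡ _

  x≤⊤ : ∀ {x} → x ≤ ⊤
  x≤⊤ = ∧-identityʳ _

  x≤⊥⇒x≈⊥ : ∀ {x} → x ≤ ⊥ → x ≈ ⊥
  x≤⊥⇒x≈⊥ {x} x≤⊥ = trans (sym x≤⊥) (∧-zeroʳ x)

  x∧x*≤⊥ : ∀ {x} → (x ∧ x *) ≤ ⊥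
  x∧x*≤⊥ = ≈⇒≤ (∧-complementʳ _)

  x∧y*≤⊥⇒x≤y : ∀ {x y} → (x ∧ y *) ≤ ⊥ → x ≤ y
  x∧y*≤⊥⇒x≤y {x} {y} x∧y*≤⊥ = sym (begin
    x                   ≈⟨ sym (∧-identityʳ x) ⟩
    x ∧ ⊤               ≈⟨ ∧-congˡ (sym (∨-complementʳ y)) ⟩
    x ∧ (y ∨ y *)       ≈⟨ ∧-distribˡ-∨ x y (y *) ⟩
    (x ∧ y) ∨ (x ∧ y *) ≈⟨ ∨-congˡ (x≤⊥⇒x≈⊥ x∧y*≤⊥) ⟩
    (x ∧ y) ∨ ⊥         ≈⟨ ∨-identityʳ _ ⟩
    x ∧ y               ∎)

  *-antitone : ∀ {x y} → x ≤ y → (y *) ≤ (x *)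
  *-antitone x≤y = x∧y*≤⊥⇒x≤y
    (≤-trans (∧-monotonic ≤-refl (≤-trans (≈⇒≤ (¬-involutive _)) x≤y)) (≈⇒≤ (∧-complementˡ _)))

  ⊤≤x∨y⇒x*≤y : ∀ {x y} → ⊤ ≤ (x ∨ y) → (x *) ≤ y
  ⊤≤x∨y⇒x*≤y {x} {y} ⊤≤x∨y = x∧y*≤⊥⇒x≤y
    (≤-trans (≈⇒≤ (sym (deMorgan₂ x y))) (≤-trans (*-antitone ⊤≤x∨y) (≈⇒≤ ¬⊤≈⊥)))

module Separation {ℓ : Level} (B : BooleanAlgebra ℓ ℓ) (ufl : BA.UltrafilterLemma B) where
  open BooleanAlgebra B hiding (¬_)
  open BA B
  open import Algebra.Lattice.Properties.BooleanAlgebra B using (deMorgan₂)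
  open BooleanOrder B
  open IsFilter
  open IsUltrafilter

  record IsIdeal (I : Pred Carrier ℓ) : Set ℓ where
    field
      bot      : I ⊥
      downward : ∀ {a b} → I b → a ≤ b → I a
      join     : ∀ {a b} → I a → I b → I (a ∨ b)

  open IsIdeal

  ↑ : Carrier → Pred Carrier ℓ
  ↑ a b = a ≤ b

  ↑-isFilter : ∀ a → IsFilter (↑ a)
  ↑-isFilter a = record { top = x≤⊤ ; upward = ≤-trans ; meet = ∧-greatest }

  module _ {U : Pred Carrier ℓ} (uU : IsUltrafilter U) where

    ultrafilter-nonzero : ∀ {a} → U a → ¬ (a ≈ ⊥)
    ultrafilter-nonzero Ua a≈⊥ = proper uU (upward (isFilter uU) Ua (≈⇒≤ a≈⊥))

    ultrafilter-meet-nonzero : ∀ {a b} → U a → U b → ¬ ((a ∧ b) ≈ ⊥)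
    ultrafilter-meet-nonzero Ua Ub = ultrafilter-nonzero (meet (isFilter uU) Ua Ub)

    ultrafilter-¬both : ∀ {a} → U a → ¬ U (a *)
    ultrafilter-¬both Ua Ua* = proper uU (upward (isFilter uU) (meet (isFilter uU) Ua Ua*) x∧x*≤⊥)

    ultrafilter-prime : ∀ {a b} → U (a ∨ b) → U a ⊎ U b
    ultrafilter-prime {a} {b} Ua∨b with ultra uU a | ultra uU b
    ... | inj₁ Ua | _      = inj₁ Ua
    ... | inj₂ _  | inj₁ Ub = inj₂ Ub
    ... | inj₂ Ua* | inj₂ Ub* = ⊥-elim (ultrafilter-¬both Ua∨b
          (upward (isFilter uU) (meet (isFilter uU) Ua* Ub*) (≈⇒≤ (sym (deMorgan₂ a b)))))

  ultrafilter-containing : ∀ {a} → ¬ (a ≈ ⊥) → ∃ λ U → IsUltrafilter U × U a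
  ultrafilter-containing {a} a≉⊥ with ufl (↑ a) (↑-isFilter a) (λ a≤⊥ → a≉⊥ (x≤⊥⇒x≈⊥ a≤⊥))
  ... | U , uU , ↑a⊆U = U , uU , ↑a⊆U ≤-refl

  filter-ideal-separation : ∀ {F I} → IsFilter F → IsIdeal I → (∀ {a} → F a → ¬ I a) →
    ∃ λ U → IsUltrafilter U × F ⊆ U × (∀ {a} → U a → ¬ I a)
  filter-ideal-separation {F} {I} fF iI F∩I=∅ with ufl G G-isFilter G-proper
    where
    G : Pred Carrier ℓ
    G a = ∃₂ λ f i → F f × I i × (f ∧ i *) ≤ a

    G-isFilter : IsFilter G
    G-isFilter = record
      { top    = ⊤ , ⊥ , top fF , bot iI , x≤⊤
      ; upward = λ { (f , i , Ff , Ii , le) a≤b → f , i , Ff , Ii , ≤-trans le a≤b }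
      ; meet   = λ { (f , i , Ff , Ii , le) (f′ , i′ , Ff′ , Ii′ , le′) →
          f ∧ f′ , i ∨ i′ , meet fF Ff Ff′ , join iI Ii Ii′ ,
          ∧-greatest (≤-trans (∧-monotonic x∧y≤x (*-antitone x≤x∨y)) le)
                     (≤-trans (∧-monotonic x∧y≤y (*-antitone y≤x∨y)) le′) } }

    G-proper : ¬ G ⊥
    G-proper (f , i , Ff , Ii , le) = F∩I=∅ Ff (downward iI Ii (x∧y*≤⊥⇒x≤y le))
  ... | U , uU , G⊆U = U , uU , F⊆U , U∩I=∅
    where
    F⊆U : F ⊆ U
    F⊆U Ff = G⊆U (_ , ⊥ , Ff , bot iI , x∧y≤x)

    U∩I=∅ : ∀ {a} → U a → ¬ I a
    U∩I=∅ Ua Ia = ultrafilter-¬both uU Ua (G⊆U (⊤ , _ , top fF , Ia , x∧y≤y))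

  ideals-avoiding-ultrafilter : ∀ {I₁ I₂} → IsIdeal I₁ → IsIdeal I₂ →
    (∀ {a b} → I₁ a → I₂ b → ¬ (⊤ ≤ (a ∨ b))) →
    ∃ λ W → IsUltrafilter W × (∀ {a} → W a → ¬ I₁ a) × (∀ {a} → W a → ¬ I₂ a)
  ideals-avoiding-ultrafilter {I₁} {I₂} iI₁ iI₂ proper-join
    with filter-ideal-separation (↑-isFilter ⊤) J-isIdeal
           (λ { ⊤≤a (b , c , I₁b , I₂c , a≤b∨c) → proper-join I₁b I₂c (≤-trans ⊤≤a a≤b∨c) })
    where
    J : Pred Carrier ℓ
    J a = ∃₂ λ b c → I₁ b × I₂ c × a ≤ (b ∨ c)

    J-isIdeal : IsIdeal J
    J-isIdeal = record
      { bot      = ⊥ , ⊥ , bot iI₁ , bot iI₂ , ⊥≤x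
      ; downward = λ { (b , c , I₁b , I₂c , le) a≤a′ → b , c , I₁b , I₂c , ≤-trans a≤a′ le }
      ; join     = λ { (b , c , I₁b , I₂c , le) (b′ , c′ , I₁b′ , I₂c′ , le′) →
          b ∨ b′ , c ∨ c′ , join iI₁ I₁b I₁b′ , join iI₂ I₂c I₂c′ ,
          ∨-least (≤-trans le (∨-monotonic x≤x∨y x≤x∨y)) (≤-trans le′ (∨-monotonic y≤x∨y y≤x∨y)) } }
  ... | W , uW , _ , W∩J=∅ =
    W , uW , (λ Wa I₁a → W∩J=∅ Wa (_ , ⊥ , I₁a , bot iI₂ , x≤x∨y))
           , (λ Wa I₂a → W∩J=∅ Wa (⊥ , _ , bot iI₁ , I₂a , y≤x∨y))

module PrecontactUltrafilters {ℓ : Level} (B : BooleanAlgebra ℓ ℓ) (ufl : BA.UltrafilterLemma B)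
                              (dne : DoubleNegationElimination ℓ) where
  open BooleanAlgebra B hiding (¬_)
  open BA B
  open BooleanOrder B
  open Separation B ufl
  open IsFilter
  open IsUltrafilter using (isFilter)

  Related : BRel → Pred Carrier ℓ → Pred Carrier ℓ → Set ℓ
  Related R F G = ∀ a b → F a → G b → R a b

  Related-flip : ∀ {R F G} → Related (flip R) F G → Related R G F
  Related-flip r a b Ga Fb = r b a Fb Ga

  flip-isPrecontact : ∀ {R} → IsPrecontact R → IsPrecontact (flip R)
  flip-isPrecontact p = record
    { nonzeroˡ = nonzeroʳ ; nonzeroʳ = nonzeroˡ
    ; mono = λ r a≤a′ b≤b′ → mono r b≤b′ a≤a′ ; splitʳ = splitˡ ; splitˡ = splitʳ }
    where open IsPrecontact p

  Unrelated : BRel → Pred Carrier ℓ → Pred Carrier ℓ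
  Unrelated R F b = ∃ λ a → F a × ¬ R a b

  Unrelated-isIdeal : ∀ {R F} → IsPrecontact R → IsFilter F → IsIdeal (Unrelated R F)
  Unrelated-isIdeal p fF = record
    { bot      = ⊤ , top fF , λ r → nonzeroʳ r refl
    ; downward = λ { (a , Fa , ¬Rab) b′≤b → a , Fa , λ r → ¬Rab (mono r ≤-refl b′≤b) }
    ; join     = λ { (a , Fa , ¬Rab) (a′ , Fa′ , ¬Ra′b′) → a ∧ a′ , meet fF Fa Fa′ ,
        λ r → [ (λ r₁ → ¬Rab (mono r₁ x∧y≤x ≤-refl)) , (λ r₂ → ¬Ra′b′ (mono r₂ x∧y≤y ≤-refl)) ]
              (splitʳ r) } }
    where open IsPrecontact p

  avoids-Unrelated⇒Related : ∀ {R F G} → (∀ {b} → G b → ¬ Unrelated R F b) → Related R F G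
  avoids-Unrelated⇒Related G∩I=∅ a b Fa Gb = dne λ ¬Rab → G∩I=∅ Gb (a , Fa , ¬Rab)

  unrelated-witness : ∀ {R F G} → ¬ Related R F G → ∃₂ λ a b → F a × G b × ¬ R a b
  unrelated-witness ¬r = dne λ ¬∃ → ¬r λ a b Fa Gb → dne λ ¬Rab → ¬∃ (a , b , Fa , Gb , ¬Rab)

  extendʳ : ∀ {R F G} → IsPrecontact R → IsFilter F → IsFilter G → Related R F G →
    ∃ λ V → IsUltrafilter V × G ⊆ V × Related R F V
  extendʳ p fF fG r with filter-ideal-separation fG (Unrelated-isIdeal p fF)
                           (λ { Gb (a , Fa , ¬Rab) → ¬Rab (r _ _ Fa Gb) })
  ... | V , uV , G⊆V , V∩I=∅ = V , uV , G⊆V , avoids-Unrelated⇒Related V∩I=∅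

  extendˡ : ∀ {R F G} → IsPrecontact R → IsFilter F → IsFilter G → Related R F G →
    ∃ λ U → IsUltrafilter U × F ⊆ U × Related R U G
  extendˡ p fF fG r with extendʳ (flip-isPrecontact p) fG fF (Related-flip r)
  ... | U , uU , F⊆U , r′ = U , uU , F⊆U , Related-flip r′

  related-ultrafilters : ∀ {R a b} → IsPrecontact R → R a b →
    ∃₂ λ U V → IsUltrafilter U × IsUltrafilter V × U a × V b × Related R U V
  related-ultrafilters {a = a} {b} p Rab
    with extendˡ p (↑-isFilter a) (↑-isFilter b) (λ _ _ a≤a′ b≤b′ → IsPrecontact.mono p Rab a≤a′ b≤b′)
  ... | U , uU , ↑a⊆U , r with extendʳ p (isFilter uU) (↑-isFilter b) r
  ... | V , uV , ↑b⊆V , r′ = U , V , uU , uV , ↑a⊆U ≤-refl , ↑b⊆V ≤-refl , r′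

  separating-ultrafilter : ∀ {R S F G} → IsPrecontact R → IsPrecontact S → IsFilter F → IsFilter G →
    (∀ {a b} c → F a → G b → R a c ⊎ S b (c *)) →
    ∃ λ W → IsUltrafilter W × Related R F W × Related S G W
  separating-ultrafilter {R} {S} {F} {G} pR pS fF fG split
    with ideals-avoiding-ultrafilter (Unrelated-isIdeal pR fF) (Unrelated-isIdeal pS fG) proper-join
    where
    proper-join : ∀ {c d} → Unrelated R F c → Unrelated S G d → ¬ (⊤ ≤ (c ∨ d))
    proper-join {c} (a , Fa , ¬Rac) (b , Gb , ¬Sbd) ⊤≤c∨d =
      [ ¬Rac , (λ Sbc* → ¬Sbd (IsPrecontact.mono pS Sbc* ≤-refl (⊤≤x∨y⇒x*≤y ⊤≤c∨d))) ] (split c Fa Gb)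
  ... | W , uW , W∩I₁=∅ , W∩I₂=∅ =
    W , uW , avoids-Unrelated⇒Related W∩I₁=∅ , avoids-Unrelated⇒Related W∩I₂=∅

module Clusters {ℓ : Level} (A : DCA ℓ) (ufl : BA.UltrafilterLemma (DCA.B A))
                (dne : DoubleNegationElimination ℓ) where
  open DCA A
  open BooleanAlgebra B hiding (¬_)
  open BA B
  open OnDCA A
  open BooleanOrder B
  open Separation B ufl
  open PrecontactUltrafilters B ufl dne
  open IsUltrafilter using (isFilter; ultra)
  open IsFilter using (top)

  Ct-precontact : IsPrecontact Ct
  Ct-precontact = IsContact.isPrecontact Ct-contact

  module Ct = IsPrecontact Ct-precontact
  module 𝓑 = IsPrecontact 𝓑-precontact

  ultrafilter-Ct : ∀ {U a b} → Ult U → U a → U b → Ct a b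
  ultrafilter-Ct uU Ua Ub = IsContact.meet-contact Ct-contact (ultrafilter-meet-nonzero uU Ua Ub)

  ≺-antitone : ∀ {Γ Γ′ Δ Δ′} → Γ′ ⊆ Γ → Δ′ ⊆ Δ → Γ ≺ Δ → Γ′ ≺ Δ′
  ≺-antitone Γ′⊆Γ Δ′⊆Δ Γ≺Δ a b Γ′a Δ′b = Γ≺Δ a b (Γ′⊆Γ Γ′a) (Δ′⊆Δ Δ′b)

  clusterOf : Subset → Subset
  clusterOf U a = ∀ b → U b → Ct a b

  ⊆-clusterOf : ∀ {U} → Ult U → U ⊆ clusterOf U
  ⊆-clusterOf uU Ua b Ub = ultrafilter-Ct uU Ua Ub

  clusterOf-prime : ∀ {U a b} → Ult U → clusterOf U (a ∨ b) → clusterOf U a ⊎ clusterOf U b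
  clusterOf-prime uU Γa∨b with extendˡ Ct-precontact (↑-isFilter _) (isFilter uU)
                                     (λ c u a∨b≤c Uu → Ct.mono (Γa∨b u Uu) a∨b≤c ≤-refl)
  ... | W , uW , ↑a∨b⊆W , r with ultrafilter-prime uW (↑a∨b⊆W ≤-refl)
  ... | inj₁ Wa = inj₁ λ u Uu → r _ u Wa Uu
  ... | inj₂ Wb = inj₂ λ u Uu → r _ u Wb Uu

  clusterOf-Ct : ∀ {U a b} → Ult U → clusterOf U a → clusterOf U b → Ct a b
  clusterOf-Ct uU Γa Γb = dne λ ¬Cab →
    let (c , ¬Cac , ¬Cc*b) = Ct-interp ¬Cab in
    [ (λ Uc → ¬Cac (Γa _ Uc)) , (λ Uc* → ¬Cc*b (IsContact.sym Ct-contact (Γb _ Uc*))) ] (ultra uU c)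

  clusterOf-isCluster : ∀ {U} → Ult U → IsCluster (clusterOf U)
  clusterOf-isCluster uU = record
    { isTClan = record
      { top     = ⊆-clusterOf uU (top (isFilter uU))
      ; bot     = λ Γ⊥ → Ct.nonzeroˡ (Γ⊥ ⊤ (top (isFilter uU))) refl
      ; upward  = λ Γa a≤b u Uu → Ct.mono (Γa u Uu) a≤b ≤-refl
      ; prime   = clusterOf-prime uU
      ; contact = clusterOf-Ct uU }
    ; maximal = λ a ¬Γa → dne λ ¬∃ → ¬Γa λ u Uu → dne λ ¬Cau → ¬∃ (u , ⊆-clusterOf uU Uu , ¬Cau) }

  clusterOf-≺ : ∀ {U V} → Ult U → Ult V → U ≺ V → clusterOf U ≺ clusterOf V
  clusterOf-≺ uU uV U≺V a b Γa Δb = dne λ ¬a𝓑b →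
    let (c , ¬Cac , ¬c*𝓑b) = 𝓑-interpˡ ¬a𝓑b
        (d , ¬c*𝓑d , ¬Cd*b) = 𝓑-interpʳ ¬c*𝓑b in
    [ (λ Uc → ¬Cac (Γa c Uc))
    , (λ Uc* → [ (λ Vd → ¬c*𝓑d (U≺V _ d Uc* Vd))
               , (λ Vd* → ¬Cd*b (IsContact.sym Ct-contact (Δb _ Vd*))) ] (ultra uV d)) ]
    (ultra uU c)

  Ct⇒common-clusterOf : ∀ {a b} → Ct a b → ∃ λ V → Ult V × clusterOf V a × clusterOf V b
  Ct⇒common-clusterOf Cab with related-ultrafilters Ct-precontact Cab
  ... | U , V , uU , uV , Ua , Vb , UCtV = V , uV , (λ v Vv → UCtV _ v Ua Vv) , ⊆-clusterOf uV Vb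

  tclan-∁-isIdeal : ∀ {Γ} → IsTClan Γ → IsIdeal (∁ Γ)
  tclan-∁-isIdeal t = record
    { bot      = bot
    ; downward = λ ¬Γb a≤b Γa → ¬Γb (upward Γa a≤b)
    ; join     = λ ¬Γa ¬Γb Γa∨b → [ ¬Γa , ¬Γb ] (prime Γa∨b) }
    where open IsTClan t

  tclan-ultrafilter : ∀ {Γ a} → IsTClan Γ → Γ a → ∃ λ U → Ult U × U a × U ⊆ Γ
  tclan-ultrafilter t Γa with filter-ideal-separation (↑-isFilter _) (tclan-∁-isIdeal t)
                                (λ a≤b ¬Γb → ¬Γb (IsTClan.upward t Γa a≤b))
  ... | U , uU , ↑a⊆U , U∩∁Γ=∅ = U , uU , ↑a⊆U ≤-refl , λ Ub → dne (U∩∁Γ=∅ Ub)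

  cluster≐clusterOf : ∀ {Γ U} → IsCluster Γ → Ult U → U ⊆ Γ → Γ ≐ clusterOf U
  cluster≐clusterOf {Γ} {U} c uU U⊆Γ = Γ⊆ , ⊆Γ
    where
    open IsCluster c
    Γ⊆ : Γ ⊆ clusterOf U
    Γ⊆ Γa u Uu = IsTClan.contact isTClan Γa (U⊆Γ Uu)

    ⊆Γ : clusterOf U ⊆ Γ
    ⊆Γ {a} Cᵤa = dne λ ¬Γa →
      let (b , Γb , ¬Cab) = maximal a ¬Γa in ¬Cab (clusterOf-Ct uU Cᵤa (Γ⊆ Γb))

  record _Represents_ (U Γ : Subset) : Set ℓ where
    field
      ultrafilter : Ult U
      cluster     : IsCluster Γ
      ⊆-cluster   : U ⊆ Γ

    ≐-clusterOf : Γ ≐ clusterOf U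
    ≐-clusterOf = cluster≐clusterOf cluster ultrafilter ⊆-cluster

  open _Represents_

  represents-clusterOf : ∀ {U} → Ult U → U Represents clusterOf U
  represents-clusterOf uU = record
    { ultrafilter = uU ; cluster = clusterOf-isCluster uU ; ⊆-cluster = ⊆-clusterOf uU }

  cluster-represented : ∀ {Γ} → IsCluster Γ → ∃ λ U → U Represents Γ
  cluster-represented c with tclan-ultrafilter (IsCluster.isTClan c) (IsTClan.top (IsCluster.isTClan c))
  ... | U , uU , _ , U⊆Γ = U , record { ultrafilter = uU ; cluster = c ; ⊆-cluster = U⊆Γ }

  module _ {U V Γ Δ} (U∼Γ : U Represents Γ) (V∼Δ : V Represents Δ) where

    ≺-represented : U ≺ V ⇔ Γ ≺ Δ
    ≺-represented = mk⇔
      (λ U≺V → ≺-antitone (proj₁ (≐-clusterOf U∼Γ)) (proj₁ (≐-clusterOf V∼Δ))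
                 (clusterOf-≺ (ultrafilter U∼Γ) (ultrafilter V∼Δ) U≺V))
      (≺-antitone (⊆-cluster U∼Γ) (⊆-cluster V∼Δ))

    Rt-represented : Rt U V ⇔ Γ ≐ Δ
    Rt-represented = mk⇔
      (λ UCtV → ≐-trans (≐-clusterOf U∼Γ)
        (≐-trans (≐-sym (cluster≐clusterOf (clusterOf-isCluster (ultrafilter V∼Δ)) (ultrafilter U∼Γ)
                                           (λ Ua v Vv → UCtV _ v Ua Vv)))
                 (≐-sym (≐-clusterOf V∼Δ))))
      (λ Γ≐Δ a b Ua Vb → IsTClan.contact (IsCluster.isTClan (cluster V∼Δ))
                           (proj₁ Γ≐Δ (⊆-cluster U∼Γ Ua)) (⊆-cluster V∼Δ Vb))

  All-transfer : ∀ {P Q : Subset → Set (suc ℓ)} → (∀ {U Γ} → U Represents Γ → P U ⇔ Q Γ) →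
    All Ult P ⇔ All IsCluster Q
  All-transfer P⇔Q = mk⇔
    (λ ∀P Γ c → let (U , U∼Γ) = cluster-represented c in
                  Equivalence.to (P⇔Q U∼Γ) (∀P U (ultrafilter U∼Γ)))
    (λ ∀Q U uU → Equivalence.from (P⇔Q (represents-clusterOf uU)) (∀Q _ (clusterOf-isCluster uU)))

  Ex-transfer : ∀ {P Q : Subset → Set ℓ} → (∀ {U Γ} → U Represents Γ → P U ⇔ Q Γ) →
    Ex Ult P ⇔ Ex IsCluster Q
  Ex-transfer P⇔Q = mk⇔
    (λ (U , uU , PU) → clusterOf U , clusterOf-isCluster uU , Equivalence.to (P⇔Q (represents-clusterOf uU)) PU)
    (λ (Γ , c , QΓ) → let (U , U∼Γ) = cluster-represented c in
                        U , ultrafilter U∼Γ , Equivalence.from (P⇔Q U∼Γ) QΓ)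

module Correspondence {ℓ : Level} (A : DCA ℓ) (ufl : BA.UltrafilterLemma (DCA.B A))
                      (dne : DoubleNegationElimination ℓ) where
  open DCA A
  open BooleanAlgebra B hiding (¬_)
  open BA B
  open OnDCA A
  open BooleanOrder B
  open Separation B ufl
  open PrecontactUltrafilters B ufl dne
  open Clusters A ufl dne
  open IsUltrafilter using (isFilter; ultra)
  open IsFilter using (top; meet)

  classical-⊎ : ∀ {P Q : Set ℓ} → (¬ P → Q) → P ⊎ Q
  classical-⊎ ¬P⇒Q = dne λ ¬P⊎Q → ¬P⊎Q (inj₂ (¬P⇒Q λ p → ¬P⊎Q (inj₁ p)))

  row : ∀ {I II : Set (suc ℓ)} {Ax : Set ℓ} → I ⇔ Lift (suc ℓ) Ax → I ⇔ II → Row I II Ax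
  row I⇔Ax I⇔II = I⇔Ax , I⇔Ax ⇔-∘ ⇔-sym I⇔II

  SerialR⇔rs : SerialR Ult ⇔ Lift (suc ℓ) rs
  SerialR⇔rs = mk⇔ to from
    where
    to : SerialR Ult → Lift (suc ℓ) rs
    to serial = lift λ a a≉⊥ →
      let (U , uU , Ua) = ultrafilter-containing a≉⊥
          (V , uV , U≺V) = serial U uU in
      U≺V a ⊤ Ua (top (isFilter uV))

    from : Lift (suc ℓ) rs → SerialR Ult
    from (lift a𝓑⊤) U uU =
      let (V , uV , _ , U≺V) = extendʳ 𝓑-precontact (isFilter uU) (↑-isFilter ⊤)
                                 λ a b Ua ⊤≤b → 𝓑.mono (a𝓑⊤ a (ultrafilter-nonzero uU Ua)) ≤-refl ⊤≤b in
      V , uV , U≺V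

  SerialL⇔ls : SerialL Ult ⇔ Lift (suc ℓ) ls
  SerialL⇔ls = mk⇔ to from
    where
    to : SerialL Ult → Lift (suc ℓ) ls
    to serial = lift λ a a≉⊥ →
      let (U , uU , Ua) = ultrafilter-containing a≉⊥
          (V , uV , V≺U) = serial U uU in
      V≺U ⊤ a (top (isFilter uV)) Ua

    from : Lift (suc ℓ) ls → SerialL Ult
    from (lift ⊤𝓑a) U uU =
      let (V , uV , _ , V≺U) = extendˡ 𝓑-precontact (↑-isFilter ⊤) (isFilter uU)
                                 λ a b ⊤≤a Ub → 𝓑.mono (⊤𝓑a b (ultrafilter-nonzero uU Ub)) ⊤≤a ≤-refl in
      V , uV , V≺U

  UpDir⇔up-dir : UpDir Ult ⇔ Lift (suc ℓ) up-dir
  UpDir⇔up-dir = mk⇔ to from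
    where
    to : UpDir Ult → Lift (suc ℓ) up-dir
    to updir = lift λ a b p a≉⊥ b≉⊥ →
      let (U , uU , Ua) = ultrafilter-containing a≉⊥
          (V , uV , Vb) = ultrafilter-containing b≉⊥
          (W , uW , U≺W , V≺W) = updir U uU V uV in
      [ (λ Wp → inj₁ (U≺W a p Ua Wp)) , (λ Wp* → inj₂ (V≺W b (p *) Vb Wp*)) ] (ultra uW p)

    from : Lift (suc ℓ) up-dir → UpDir Ult
    from (lift updir) U uU V uV =
      separating-ultrafilter 𝓑-precontact 𝓑-precontact (isFilter uU) (isFilter uV)
        λ p Ua Vb → updir _ _ p (ultrafilter-nonzero uU Ua) (ultrafilter-nonzero uV Vb)

  DownDir⇔down-dir : DownDir Ult ⇔ Lift (suc ℓ) down-dir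
  DownDir⇔down-dir = mk⇔ to from
    where
    to : DownDir Ult → Lift (suc ℓ) down-dir
    to downdir = lift λ a b p a≉⊥ b≉⊥ →
      let (U , uU , Ua) = ultrafilter-containing a≉⊥
          (V , uV , Vb) = ultrafilter-containing b≉⊥
          (W , uW , W≺U , W≺V) = downdir U uU V uV in
      [ (λ Wp → inj₁ (W≺U p a Wp Ua)) , (λ Wp* → inj₂ (W≺V (p *) b Wp* Vb)) ] (ultra uW p)

    from : Lift (suc ℓ) down-dir → DownDir Ult
    from (lift downdir) U uU V uV =
      let 𝓑ᵒᵖ = flip-isPrecontact 𝓑-precontact
          (W , uW , U≻W , V≻W) = separating-ultrafilter 𝓑ᵒᵖ 𝓑ᵒᵖ (isFilter uU) (isFilter uV)
            λ p Ua Vb → downdir _ _ p (ultrafilter-nonzero uU Ua) (ultrafilter-nonzero uV Vb) in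
      W , uW , Related-flip U≻W , Related-flip V≻W

  Circ⇔circ : Circ Ult ⇔ Lift (suc ℓ) circ
  Circ⇔circ = mk⇔ to from
    where
    to : Circ Ult → Lift (suc ℓ) circ
    to circular = lift λ a b p a𝓑b →
      let (U , V , uU , uV , Ua , Vb , U≺V) = related-ultrafilters 𝓑-precontact a𝓑b
          (W , uW , W≺U , V≺W) = circular U uU V uV U≺V in
      [ (λ Wp → inj₁ (V≺W b p Vb Wp)) , (λ Wp* → inj₂ (W≺U (p *) a Wp* Ua)) ] (ultra uW p)

    from : Lift (suc ℓ) circ → Circ Ult
    from (lift circular) U uU V uV U≺V =
      let (W , uW , V≺W , U≻W) = separating-ultrafilter 𝓑-precontact (flip-isPrecontact 𝓑-precontact)
                                   (isFilter uV) (isFilter uU)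
                                   λ p Vb Ua → circular _ _ p (U≺V _ _ Ua Vb) in
      W , uW , Related-flip U≻W , V≺W

  Dens⇔dens : Dens Ult ⇔ Lift (suc ℓ) dens
  Dens⇔dens = mk⇔ to from
    where
    to : Dens Ult → Lift (suc ℓ) dens
    to dense = lift λ a b p a𝓑b →
      let (U , V , uU , uV , Ua , Vb , U≺V) = related-ultrafilters 𝓑-precontact a𝓑b
          (W , uW , U≺W , W≺V) = dense U uU V uV U≺V in
      [ (λ Wp → inj₁ (U≺W a p Ua Wp)) , (λ Wp* → inj₂ (W≺V (p *) b Wp* Vb)) ] (ultra uW p)

    from : Lift (suc ℓ) dens → Dens Ult
    from (lift dense) U uU V uV U≺V =
      let (W , uW , U≺W , V≻W) = separating-ultrafilter 𝓑-precontact (flip-isPrecontact 𝓑-precontact)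
                                   (isFilter uU) (isFilter uV)
                                   λ p Ua Vb → dense _ _ p (U≺V _ _ Ua Vb) in
      W , uW , U≺W , Related-flip V≻W

  Refl⇔ref : Refl Ult ⇔ Lift (suc ℓ) ref
  Refl⇔ref = mk⇔ to from
    where
    to : Refl Ult → Lift (suc ℓ) ref
    to reflexive = lift λ a b Cab →
      let (V , uV , Γa , Γb) = Ct⇒common-clusterOf Cab in
      clusterOf-≺ uV uV (lower (reflexive V uV)) a b Γa Γb

    from : Lift (suc ℓ) ref → Refl Ult
    from (lift Ct⇒𝓑) U uU = lift λ a b Ua Ub → Ct⇒𝓑 a b (ultrafilter-Ct uU Ua Ub)

  Lin⇔lin : Lin Ult ⇔ Lift (suc ℓ) lin
  Lin⇔lin = mk⇔ to from
    where
    to : Lin Ult → Lift (suc ℓ) lin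
    to linear = lift λ a b a≉⊥ b≉⊥ →
      let (U , uU , Ua) = ultrafilter-containing a≉⊥
          (V , uV , Vb) = ultrafilter-containing b≉⊥ in
      [ (λ U≺V → inj₁ (U≺V a b Ua Vb)) , (λ V≺U → inj₂ (V≺U b a Vb Ua)) ] (lower (linear U uU V uV))

    -- failures of U ≺ V and of V ≺ U are witnessed by a single pair, after meeting the witnesses
    from : Lift (suc ℓ) lin → Lin Ult
    from (lift linear) U uU V uV = lift (classical-⊎ λ ¬U≺V → dne λ ¬V≺U →
      let (a , b , Ua , Vb , ¬a𝓑b) = unrelated-witness ¬U≺V
          (b′ , a′ , Vb′ , Ua′ , ¬b′𝓑a′) = unrelated-witness ¬V≺U in
      [ (λ r → ¬a𝓑b (𝓑.mono r x∧y≤x x∧y≤x)) , (λ r → ¬b′𝓑a′ (𝓑.mono r x∧y≤y x∧y≤y)) ]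
      (linear (a ∧ a′) (b ∧ b′) (ultrafilter-meet-nonzero uU Ua Ua′)
                                (ultrafilter-meet-nonzero uV Vb Vb′)))

  Tri⇔tri : Tri Ult Rt ⇔ Lift (suc ℓ) tri
  Tri⇔tri = mk⇔ to from
    where
    to : Tri Ult Rt → Lift (suc ℓ) tri
    to trichotomous = lift λ a b a≉⊥ b≉⊥ →
      let (U , uU , Ua) = ultrafilter-containing a≉⊥
          (V , uV , Vb) = ultrafilter-containing b≉⊥ in
      [ (λ UCtV → inj₁ (UCtV a b Ua Vb))
      , [ (λ U≺V → inj₂ (inj₁ (U≺V a b Ua Vb))) , (λ V≺U → inj₂ (inj₂ (V≺U b a Vb Ua))) ] ]
      (lower (trichotomous U uU V uV))

    from : Lift (suc ℓ) tri → Tri Ult Rt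
    from (lift trichotomous) U uU V uV =
      lift (classical-⊎ λ ¬UCtV → classical-⊎ λ ¬U≺V → dne λ ¬V≺U →
      let (a , b , Ua , Vb , ¬Cab) = unrelated-witness ¬UCtV
          (a′ , b′ , Ua′ , Vb′ , ¬a′𝓑b′) = unrelated-witness ¬U≺V
          (b″ , a″ , Vb″ , Ua″ , ¬b″𝓑a″) = unrelated-witness ¬V≺U in
      [ (λ r → ¬Cab (Ct.mono r x∧y≤x x∧y≤x))
      , [ (λ r → ¬a′𝓑b′ (𝓑.mono r (≤-trans x∧y≤y x∧y≤x) (≤-trans x∧y≤y x∧y≤x)))
        , (λ r → ¬b″𝓑a″ (𝓑.mono r (≤-trans x∧y≤y x∧y≤y) (≤-trans x∧y≤y x∧y≤y))) ] ]
      (trichotomous (a ∧ (a′ ∧ a″)) (b ∧ (b′ ∧ b″))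
        (ultrafilter-meet-nonzero uU Ua (meet (isFilter uU) Ua′ Ua″))
        (ultrafilter-meet-nonzero uV Vb (meet (isFilter uV) Vb′ Vb″))))

  Trans⇔tr : Trans Ult ⇔ Lift (suc ℓ) tr
  Trans⇔tr = mk⇔ to from
    where
    -- if tr failed at a, b, an ultrafilter V with ↑a ≺ V ≺ ↑b would break transitivity
    to : Trans Ult → Lift (suc ℓ) tr
    to transitive = lift λ a b ¬a𝓑b → dne λ ¬tr →
      let split : ∀ {a′ b′} c → a ≤ a′ → b ≤ b′ → 𝓑 a′ c ⊎ 𝓑 (c *) b′
          split c a≤a′ b≤b′ = Sum.map (λ a𝓑c → 𝓑.mono a𝓑c a≤a′ ≤-refl)
                                      (λ c*𝓑b → 𝓑.mono c*𝓑b ≤-refl b≤b′)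
                              (classical-⊎ λ ¬a𝓑c → dne λ ¬c*𝓑b → ¬tr (c , ¬a𝓑c , ¬c*𝓑b))
          (V , uV , ↑a≺V , ↑b≻V) = separating-ultrafilter 𝓑-precontact (flip-isPrecontact 𝓑-precontact)
                                     (↑-isFilter a) (↑-isFilter b) split
          (U , uU , ↑a⊆U , U≺V) = extendˡ 𝓑-precontact (↑-isFilter a) (isFilter uV) ↑a≺V
          (W , uW , ↑b⊆W , V≺W) = extendʳ 𝓑-precontact (isFilter uV) (↑-isFilter b) (Related-flip ↑b≻V) in
      ¬a𝓑b (lower (transitive U uU V uV W uW) U≺V V≺W a b (↑a⊆U ≤-refl) (↑b⊆W ≤-refl))

    from : Lift (suc ℓ) tr → Trans Ult
    from (lift interpolate) U uU V uV W uW = lift λ U≺V V≺W a b Ua Wb → dne λ ¬a𝓑b →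
      let (c , ¬a𝓑c , ¬c*𝓑b) = interpolate a b ¬a𝓑b in
      [ (λ Vc → ¬a𝓑c (U≺V a c Ua Vc)) , (λ Vc* → ¬c*𝓑b (V≺W (c *) b Vc* Wb)) ] (ultra uV c)

  SerialR-transfer : SerialR Ult ⇔ SerialR IsCluster
  SerialR-transfer = All-transfer λ U∼Γ → Ex-transfer λ V∼Δ → ≺-represented U∼Γ V∼Δ

  SerialL-transfer : SerialL Ult ⇔ SerialL IsCluster
  SerialL-transfer = All-transfer λ U∼Γ → Ex-transfer λ V∼Δ → ≺-represented V∼Δ U∼Γ

  UpDir-transfer : UpDir Ult ⇔ UpDir IsCluster
  UpDir-transfer = All-transfer λ U∼Γ → All-transfer λ V∼Δ → Ex-transfer λ W∼Θ →
    ≺-represented U∼Γ W∼Θ ×-⇔ ≺-represented V∼Δ W∼Θ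

  DownDir-transfer : DownDir Ult ⇔ DownDir IsCluster
  DownDir-transfer = All-transfer λ U∼Γ → All-transfer λ V∼Δ → Ex-transfer λ W∼Θ →
    ≺-represented W∼Θ U∼Γ ×-⇔ ≺-represented W∼Θ V∼Δ

  Circ-transfer : Circ Ult ⇔ Circ IsCluster
  Circ-transfer = All-transfer λ U∼Γ → All-transfer λ V∼Δ → →-cong-⇔ (≺-represented U∼Γ V∼Δ)
    (Ex-transfer λ W∼Θ → ≺-represented W∼Θ U∼Γ ×-⇔ ≺-represented V∼Δ W∼Θ)

  Dens-transfer : Dens Ult ⇔ Dens IsCluster
  Dens-transfer = All-transfer λ U∼Γ → All-transfer λ V∼Δ → →-cong-⇔ (≺-represented U∼Γ V∼Δ)
    (Ex-transfer λ W∼Θ → ≺-represented U∼Γ W∼Θ ×-⇔ ≺-represented W∼Θ V∼Δ)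

  Refl-transfer : Refl Ult ⇔ Refl IsCluster
  Refl-transfer = All-transfer λ U∼Γ → Lift-cong (≺-represented U∼Γ U∼Γ)

  Lin-transfer : Lin Ult ⇔ Lin IsCluster
  Lin-transfer = All-transfer λ U∼Γ → All-transfer λ V∼Δ →
    Lift-cong (≺-represented U∼Γ V∼Δ ⊎-⇔ ≺-represented V∼Δ U∼Γ)

  Tri-transfer : Tri Ult Rt ⇔ Tri IsCluster _≐_
  Tri-transfer = All-transfer λ U∼Γ → All-transfer λ V∼Δ →
    Lift-cong (Rt-represented U∼Γ V∼Δ ⊎-⇔ ≺-represented U∼Γ V∼Δ ⊎-⇔ ≺-represented V∼Δ U∼Γ)

  Trans-transfer : Trans Ult ⇔ Trans IsCluster
  Trans-transfer = All-transfer λ U∼Γ → All-transfer λ V∼Δ → All-transfer λ W∼Θ →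
    Lift-cong (→-cong-⇔ (≺-represented U∼Γ V∼Δ)
              (→-cong-⇔ (≺-represented V∼Δ W∼Θ) (≺-represented U∼Γ W∼Θ)))

lemma4p9 : {ℓ : Level} → ExcludedMiddle (suc ℓ) →
           (A : DCA ℓ) → BA.UltrafilterLemma (DCA.B A) →
           OnDCA.AllRows A
lemma4p9 em A ufl =
    row SerialR⇔rs SerialR-transfer
  , row SerialL⇔ls SerialL-transfer
  , row UpDir⇔up-dir UpDir-transfer
  , row DownDir⇔down-dir DownDir-transfer
  , row Circ⇔circ Circ-transfer
  , row Dens⇔dens Dens-transfer
  , row Refl⇔ref Refl-transfer
  , row Lin⇔lin Lin-transfer
  , row Tri⇔tri Tri-transfer
  , row Trans⇔tr Trans-transfer
  where open Correspondence A ufl (em⇒dne (lower-excludedMiddle em))
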